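{- For every node $\alpha$ of $T$, every $(d,k)\in R_\alpha$ and every $v\in X_\alpha$, we have $k\ge d(v)$.
   Context: $G=(V,E)$ is a simple undirected graph and $c:V\to\mathbb{N}$ a capacity function; $(T,\mathcal{X})$ is a (nice) tree decomposition of $G$ with bags $X_\alpha$. For a node $\alpha$, $V_\alpha$ is the union of the bags in the subtree rooted at $\alpha$, $Y_\alpha=V_\alpha\setminus X_\alpha$, and $G_\alpha$ is the graph with vertex set $V_\alpha$ and edge set $E[V_\alpha]\setminus E[X_\alpha]$. $R_\alpha$ is the set of pairs $(d,k)$ with $d:X_\alpha\to\mathbb{N}$, $k\in\mathbb{N}$, for which there is an orientation $O$ of $G_\alpha$ with: (1) $d(v)$ equals the out-degree of $v$ in $O$ for all $v\in X_\alpha$; (2) the in-degree of $v$ in $O$ is at most $c(v)$ for all $v\in Y_\alpha$; (3) the number of $v\in Y_\alpha$ with positive in-degree in $O$ is at most $k$, and $k\le|Y_\alpha|$. -}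

module Defs where

open import Data.Nat using (ℕ; _≤_; _<ᵇ_)
open import Data.Bool using (Bool; true; false)
open import Data.Fin using (Fin)
open import Data.Fin.Subset using (Subset; _∈_; _∉_; ⁅_⁆; ∁; _∩_; _∪_; ∣_∣)
  renaming (⊥ to ∅)
open import Data.Vec using (tabulate; lookup)
open import Data.List using (List; []; _∷_; length)
import Data.List as L
open import Data.List.Membership.Propositional using () renaming (_∈_ to _∈ₗ_)
open import Data.Product using (Σ; ∃; _×_)
open import Data.Sum using (_⊎_)
open import Relation.Nullary using (¬_)
open import Relation.Binary.PropositionalEquality using (_≡_; _≢_)

record Graph (n : ℕ) : Set where
  field
    adj    : Fin n → Fin n → Bool
    sym    : ∀ u v → adj u v ≡ adj v u
    irrefl : ∀ v → adj v v ≡ false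
open Graph public

-- A rooted tree T whose nodes carry bags X_α ⊆ V.  Each subtree is a node α.
data TD (n : ℕ) : Set where
  node : Subset n → List (TD n) → TD n

bag : ∀ {n} → TD n → Subset n
bag (node B _) = B

children : ∀ {n} → TD n → List (TD n)
children (node _ ts) = ts

mutual
  verts : ∀ {n} → TD n → Subset n
  verts (node B ts) = B ∪ vertsL ts

  vertsL : ∀ {n} → List (TD n) → Subset n
  vertsL []       = ∅
  vertsL (t ∷ ts) = verts t ∪ vertsL ts

-- α ≼ T : α is a node of T (the subtree of T rooted at α)
data _≼_ {n : ℕ} (α : TD n) : TD n → Set where
  here  : α ≼ α
  below : ∀ {B ts s} → s ∈ₗ ts → α ≼ s → α ≼ node B ts

Yset : ∀ {n} → TD n → Subset n
Yset α = verts α ∩ ∁ (bag α)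

-- Local form of the connectivity condition at a node (for all nodes it is
-- equivalent to: for each vertex v the nodes whose bags contain v form a
-- connected subtree).
LocalConn : ∀ {n} → TD n → Set
LocalConn (node B ts) =
  (∀ v (i j : Fin (length ts)) → i ≢ j →
     v ∈ verts (L.lookup ts i) → v ∈ verts (L.lookup ts j) → v ∈ B)
  × (∀ v (i : Fin (length ts)) →
     v ∈ verts (L.lookup ts i) → v ∈ B → v ∈ bag (L.lookup ts i))

IsTreeDecomposition : ∀ {n} → Graph n → TD n → Set
IsTreeDecomposition {n} G T =
  (∀ (v : Fin n) → v ∈ verts T)
  × (∀ u v → adj G u v ≡ true → Σ (TD n) λ α → α ≼ T × u ∈ bag α × v ∈ bag α)
  × (∀ α → α ≼ T → LocalConn α)

NiceNode : ∀ {n} → TD n → Set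
NiceNode (node B [])            = Data.Unit.⊤ where import Data.Unit
NiceNode {n} (node B (s ∷ []))  =
  (Σ (Fin n) λ v → v ∉ bag s × B ≡ bag s ∪ ⁅ v ⁆)
  ⊎ (Σ (Fin n) λ v → v ∈ bag s × B ≡ bag s ∩ ∁ ⁅ v ⁆)
NiceNode (node B (s₁ ∷ s₂ ∷ [])) = bag s₁ ≡ B × bag s₂ ≡ B
NiceNode (node B (_ ∷ _ ∷ _ ∷ _)) = Data.Empty.⊥ where import Data.Empty

IsNiceTreeDecomposition : ∀ {n} → Graph n → TD n → Set
IsNiceTreeDecomposition G T = IsTreeDecomposition G T × (∀ α → α ≼ T → NiceNode α)

EdgeG : ∀ {n} → Graph n → TD n → Fin n → Fin n → Set
EdgeG G α u v = adj G u v ≡ true × u ∈ verts α × v ∈ verts α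
                × ¬ (u ∈ bag α × v ∈ bag α)

-- o u v ≡ true means the edge uv is oriented u → v.
IsOrientation : ∀ {n} → Graph n → TD n → (Fin n → Fin n → Bool) → Set
IsOrientation G α o =
  (∀ u v → o u v ≡ true → EdgeG G α u v)
  × (∀ u v → EdgeG G α u v → o u v ≡ true ⊎ o v u ≡ true)
  × (∀ u v → ¬ (o u v ≡ true × o v u ≡ true))

outdeg : ∀ {n} → (Fin n → Fin n → Bool) → Fin n → ℕ
outdeg o v = ∣ tabulate (o v) ∣

indeg : ∀ {n} → (Fin n → Fin n → Bool) → Fin n → ℕ
indeg o v = ∣ tabulate (λ u → o u v) ∣

-- (d , k) ∈ R_α   (d is only relevant on X_α)
InR : ∀ {n} → Graph n → (Fin n → ℕ) → TD n → (Fin n → ℕ) → ℕ → Set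
InR G c α d k = Σ (Fin _ → Fin _ → Bool) λ o →
  IsOrientation G α o
  × (∀ v → v ∈ bag α → d v ≡ outdeg o v)
  × (∀ v → v ∈ Yset α → indeg o v ≤ c v)
  × ∣ Yset α ∩ tabulate (λ v → 0 <ᵇ indeg o v) ∣ ≤ k
  × k ≤ ∣ Yset α ∣

-- If the edge vu of G_α is oriented v → u with v ∈ X_α, then u ∉ X_α (edges inside X_α
-- are not in G_α), so u ∈ Y_α, and u has positive in-degree.  Hence the out-neighbours
-- of v are among the vertices of Y_α with positive in-degree, of which there are at most k.
module Submission where

open import Defs hiding (sym)
open import Data.Nat using (ℕ; _≤_; _<ᵇ_)
open import Data.Nat.Properties using (≤-trans; <⇒<ᵇ)
open import Data.Bool using (Bool; true)
open import Data.Bool.Properties using (T-≡)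
open import Data.Fin using (Fin)
open import Data.Fin.Subset using (Subset; _∈_; _⊆_; ∣_∣; _∩_)
open import Data.Fin.Subset.Properties
  using (p⊆q⇒∣p∣≤∣q∣; ∣⁅x⁆∣≡1; x∈⁅y⁆⇒x≡y; x∈p∩q⁺; x∉p⇒x∈∁p)
open import Data.Vec using (tabulate)
open import Data.Vec.Properties using (lookup⇒[]=; []=⇒lookup; lookup∘tabulate)
open import Data.Product using (_,_)
open import Function.Bundles using (Equivalence)
open import Relation.Binary.PropositionalEquality using (_≡_; sym; trans; subst)

∈-tabulate⁺ : ∀ {n} (f : Fin n → Bool) {x} → f x ≡ true → x ∈ tabulate f
∈-tabulate⁺ f {x} fx = lookup⇒[]= x (tabulate f) (trans (lookup∘tabulate f x) fx)

∈-tabulate⁻ : ∀ {n} (f : Fin n → Bool) {x} → x ∈ tabulate f → f x ≡ true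
∈-tabulate⁻ f {x} x∈ = trans (sym (lookup∘tabulate f x)) ([]=⇒lookup x∈)

x∈p⇒1≤∣p∣ : ∀ {n} {p : Subset n} {x} → x ∈ p → 1 ≤ ∣ p ∣
x∈p⇒1≤∣p∣ {p = p} {x} x∈p =
  subst (_≤ ∣ p ∣) (∣⁅x⁆∣≡1 x)
        (p⊆q⇒∣p∣≤∣q∣ (λ y∈⁅x⁆ → subst (_∈ p) (sym (x∈⁅y⁆⇒x≡y x y∈⁅x⁆)) x∈p))

outNeighbours : ∀ {n} → (Fin n → Fin n → Bool) → Fin n → Subset n
outNeighbours o v = tabulate (o v)

hasInArc : ∀ {n} → (Fin n → Fin n → Bool) → Subset n
hasInArc o = tabulate (λ u → 0 <ᵇ indeg o u)

arc⇒hasInArc : ∀ {n} (o : Fin n → Fin n → Bool) {v u} → o v u ≡ true → u ∈ hasInArc o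
arc⇒hasInArc o {v} {u} vu =
  ∈-tabulate⁺ _ (Equivalence.to T-≡ (<⇒<ᵇ (x∈p⇒1≤∣p∣ (∈-tabulate⁺ (λ w → o w u) vu))))

outNeighbours-bag⊆Y : ∀ {n} (G : Graph n) (α : TD n) {o v} → IsOrientation G α o →
  v ∈ bag α → outNeighbours o v ⊆ Yset α ∩ hasInArc o
outNeighbours-bag⊆Y G α {o} {v} (arc⇒edge , _) v∈X {u} u∈N
  with vu ← ∈-tabulate⁻ (o v) u∈N
  with (_ , _ , u∈V , ¬bothInX) ← arc⇒edge v u vu =
  x∈p∩q⁺ (x∈p∩q⁺ (u∈V , x∉p⇒x∈∁p (λ u∈X → ¬bothInX (v∈X , u∈X))) , arc⇒hasInArc o vu)

outdeg-bag≤∣Y∩hasInArc∣ : ∀ {n} (G : Graph n) (α : TD n) {o v} → IsOrientation G α o →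
  v ∈ bag α → outdeg o v ≤ ∣ Yset α ∩ hasInArc o ∣
outdeg-bag≤∣Y∩hasInArc∣ G α isOr v∈X = p⊆q⇒∣p∣≤∣q∣ (outNeighbours-bag⊆Y G α isOr v∈X)

lemma9 : ∀ {n} (G : Graph n) (c : Fin n → ℕ) (T : TD n) →
    IsNiceTreeDecomposition G T →
    ∀ (α : TD n) → α ≼ T →
    ∀ (d : Fin n → ℕ) (k : ℕ) → InR G c α d k →
    ∀ (v : Fin n) → v ∈ bag α → d v ≤ k
lemma9 G c T _ α _ d k (o , isOr , d≡outdeg , _ , count≤k , _) v v∈X =
  subst (_≤ k) (sym (d≡outdeg v v∈X))
        (≤-trans (outdeg-bag≤∣Y∩hasInArc∣ G α isOr v∈X) count≤k)
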